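{- Let $d\ge1$ be an integer. Let $\mathcal{H}_d$ be the set of non-empty partitions whose parts pairwise differ by at least $d$, and $\mathcal{F}_d$ the set of non-empty partitions all of whose parts are $\equiv 1\pmod{d+1}$. Then, as formal power series, $$\sum_{\pi\in\mathcal{H}_d}x^{\pi_1}y^{\ell(\pi)}q^{\Gamma(\pi)}=\frac{xyq}{1-(xq+x^dyq^{d+1})},\qquad \sum_{\pi\in\mathcal{F}_d}x^{\pi_1}y^{\ell(\pi)}q^{\Gamma(\pi)}=\frac{xyq}{1-(yq+x^{d+1}q^{d+1})}.$$ In particular, for all $n\ge1$, $h_d(n)=f_d(n)$, where $h_d(n)$ (resp. $f_d(n)$) is the number of $\pi\in\mathcal{H}_d$ (resp. $\pi\in\mathcal{F}_d$) with $\Gamma(\pi)=n$.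
   Context: For a non-empty partition $\pi=(\pi_1\ge\cdots\ge\pi_r\ge1)$, $\ell(\pi)=r$ and $\Gamma(\pi)=\pi_1+\ell(\pi)-1$ (length of the largest hook). -}

module Defs where

open import Data.Nat using (ℕ; zero; suc; _+_; _∸_; _≤_; _≥_; _^_; _≡ᵇ_)
open import Data.Nat.DivMod using (_%_)
open import Data.Bool using (if_then_else_; _∧_)
open import Data.Integer as ℤ using (ℤ; +_)
open import Data.List using (List; []; _∷_; length)
open import Data.List.Relation.Unary.All using (All)
open import Data.List.Relation.Unary.AllPairs using (AllPairs)
open import Data.List.Relation.Unary.Linked using (Linked)
open import Data.Product using (Σ; _×_)
open import Relation.Binary.PropositionalEquality using (_≡_)

IsPartition : List ℕ → Set
IsPartition l = Linked _≥_ l × All (1 ≤_) l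

NonEmpty : List ℕ → Set
NonEmpty l = 1 ≤ length l

-- largest part π₁ (0 for the empty list, which never occurs below)
largest : List ℕ → ℕ
largest []      = 0
largest (p ∷ _) = p

len : List ℕ → ℕ
len = length

Γ : List ℕ → ℕ
Γ l = largest l + len l ∸ 1

-- 𝓗_d : non-empty partitions whose parts pairwise differ by at least d
-- (list is non-increasing, so for earlier x and later y: y + d ≤ x)
InH : ℕ → List ℕ → Set
InH d l = IsPartition l × NonEmpty l × AllPairs (λ x y → y + d ≤ x) l

InF : ℕ → List ℕ → Set
InF d l = IsPartition l × NonEmpty l × All (λ p → p % suc d ≡ 1 % suc d) l

HSet : ℕ → ℕ → ℕ → ℕ → Set
HSet d a b n = Σ (List ℕ) λ l → InH d l × largest l ≡ a × len l ≡ b × Γ l ≡ n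

FSet : ℕ → ℕ → ℕ → ℕ → Set
FSet d a b n = Σ (List ℕ) λ l → InF d l × largest l ≡ a × len l ≡ b × Γ l ≡ n

HΓ : ℕ → ℕ → Set
HΓ d n = Σ (List ℕ) λ l → InH d l × Γ l ≡ n

FΓ : ℕ → ℕ → Set
FΓ d n = Σ (List ℕ) λ l → InF d l × Γ l ≡ n

-- Formal power series in x, y, q over ℤ: coefficient of x^a y^b q^c.

FPS : Set
FPS = ℕ → ℕ → ℕ → ℤ

sumTo : ℕ → (ℕ → ℤ) → ℤ
sumTo zero    f = f 0
sumTo (suc n) f = sumTo n f ℤ.+ f (suc n)

_⊕_ : FPS → FPS → FPS
(f ⊕ g) a b c = f a b c ℤ.+ g a b c

_⊖_ : FPS → FPS → FPS
(f ⊖ g) a b c = f a b c ℤ.- g a b c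

_⊛_ : FPS → FPS → FPS
(f ⊛ g) a b c =
  sumTo a λ i → sumTo b λ j → sumTo c λ k →
    f i j k ℤ.* g (a ∸ i) (b ∸ j) (c ∸ k)

mono : ℕ → ℕ → ℕ → FPS
mono i j k a b c = if (a ≡ᵇ i) ∧ (b ≡ᵇ j) ∧ (c ≡ᵇ k) then + 1 else + 0

fromℕ : (ℕ → ℕ → ℕ → ℕ) → FPS
fromℕ g a b c = + g a b c

denomH : ℕ → FPS
denomH d = mono 0 0 0 ⊖ (mono 1 0 1 ⊕ mono d 1 (suc d))

denomF : ℕ → FPS
denomF d = mono 0 0 0 ⊖ (mono 0 1 1 ⊕ mono (suc d) 0 (suc d))

module Submission where

-- Every member of 𝓗_d other than (1) arises in exactly one way from a smaller member: by adding 1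
-- to its largest part, or by prepending the part π₁ + d. These operations shift (π₁, ℓ, Γ) by
-- (1, 0, 1) and (d, 1, d + 1), so the generating function G satisfies G = xyq + (xq + x^d y q^(d+1)) G.
-- For 𝓕_d the two operations are adding d + 1 to the largest part and repeating it, with shifts
-- (d + 1, 0, d + 1) and (0, 1, 1). Counted by Γ alone, both families therefore satisfy
-- a(n) = a(n − 1) + a(n − d − 1) with a(0) = 0 and a(1) = 1, so h_d = f_d.

open import Defs
open import Data.Bool using (if_then_else_)
open import Data.Fin using (Fin)
open import Data.Fin.Patterns using (0F)
open import Data.Fin.Permutation using (↔⇒≡)
open import Data.Fin.Properties using (+↔⊎; 1↔⊤)
open import Data.Integer as ℤ using (ℤ; 0ℤ; 1ℤ)
import Data.Integer.Properties as ℤₚ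
open import Data.Integer.Tactic.RingSolver using (solve-∀)
open import Data.List using (List; []; _∷_; length)
open import Data.List.Properties using (∷-injective; ∷-injectiveʳ)
open import Data.List.Relation.Unary.All as All using ([]; _∷_)
open import Data.List.Relation.Unary.AllPairs as AllPairs using ([]; _∷_)
open import Data.List.Relation.Unary.Linked as Linked using (Linked; [-]; _∷_)
open import Data.Nat using (ℕ; zero; suc; _+_; _*_; _∸_; _≤_; _<_; _≥_; z≤n; s≤s; NonZero)
open import Data.Nat.Divisibility using (∣-refl)
open import Data.Nat.DivMod using (_%_; _/_; m≡m%n+[m/n]*n; m≤n⇒[n∸m]%m≡n%m; %-remove-+ˡ)
open import Data.Nat.Induction using (<-rec)
open import Data.Nat.Properties
open import Data.Product using (Σ; _×_; _,_; proj₁; proj₂; uncurry)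
open import Data.Product.Function.NonDependent.Propositional using (_×-⇔_)
open import Data.Product.Properties using (Σ-≡,≡→≡)
open import Data.Sum using (_⊎_; inj₁; inj₂)
open import Data.Sum.Function.Propositional using (_⊎-cong_)
open import Data.Unit using (⊤; tt)
open import Function using (_∘_)
open import Function.Bundles using (_↔_; _⇔_; mk↔ₛ′; Inverse; Equivalence; mk⇔)
open import Function.Properties.Inverse using (↔-sym; ↔-trans)
import Relation.Nullary as Nullary
open import Relation.Nullary using (¬_; yes; no; _×-dec_; contradiction)
open import Relation.Nullary.Decidable using (dec-true; dec-false)
open import Relation.Unary using (Irrelevant; _∩_)
open import Relation.Binary.PropositionalEquality
open import Algebra.Definitions {A = ℤ} _≡_ using (Interchangable; _DistributesOverˡ_)

card-empty : ∀ {m} {A : Set} → Fin m ↔ A → ¬ A → m ≡ 0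
card-empty {zero}  _    _  = refl
card-empty {suc _} m↔A ¬a = contradiction (Inverse.to m↔A 0F) ¬a

card-singleton : ∀ {m} {A : Set} → Fin m ↔ A → (a : A) → (∀ a′ → a ≡ a′) → m ≡ 1
card-singleton {A = A} m↔A a unique = ↔⇒≡ (↔-trans m↔A (↔-trans A↔⊤ (↔-sym 1↔⊤)))
  where
  A↔⊤ : A ↔ ⊤
  A↔⊤ = mk↔ₛ′ (λ _ → tt) (λ _ → a) (λ _ → refl) unique

card-⊎ : ∀ {m k l} {A B C : Set} → Fin m ↔ A → Fin k ↔ B → Fin l ↔ C → A ↔ (B ⊎ C) → m ≡ k + l
card-⊎ m↔A k↔B l↔C A↔B⊎C = ↔⇒≡ (↔-trans m↔A (↔-trans A↔B⊎C (↔-trans (↔-sym k↔B ⊎-cong ↔-sym l↔C) (↔-sym +↔⊎))))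

sumTo-cong : ∀ n {f g : ℕ → ℤ} → (∀ {t} → t ≤ n → f t ≡ g t) → sumTo n f ≡ sumTo n g
sumTo-cong zero    f≗g = f≗g z≤n
sumTo-cong (suc n) f≗g = cong₂ ℤ._+_ (sumTo-cong n (f≗g ∘ m≤n⇒m≤1+n)) (f≗g ≤-refl)

sumTo-zero : ∀ n {f : ℕ → ℤ} → (∀ {t} → t ≤ n → f t ≡ 0ℤ) → sumTo n f ≡ 0ℤ
sumTo-zero zero    f≗0 = f≗0 z≤n
sumTo-zero (suc n) f≗0 = cong₂ ℤ._+_ (sumTo-zero n (f≗0 ∘ m≤n⇒m≤1+n)) (f≗0 ≤-refl)

sumTo-select : ∀ n {f : ℕ → ℤ} {s} → s ≤ n → (∀ {t} → t ≤ n → t ≢ s → f t ≡ 0ℤ) → sumTo n f ≡ f s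
sumTo-select zero    z≤n _ = refl
sumTo-select (suc n) {f} {s} s≤1+n off with s ≟ suc n
... | yes refl = trans (cong (ℤ._+ f s) (sumTo-zero n (λ t≤n → off (m≤n⇒m≤1+n t≤n) λ { refl → 1+n≰n t≤n })))
                       (ℤₚ.+-identityˡ (f s))
... | no s≢1+n = trans (cong₂ ℤ._+_ (sumTo-select n (m<1+n⇒m≤n (≤∧≢⇒< s≤1+n s≢1+n)) (off ∘ m≤n⇒m≤1+n))
                                    (off ≤-refl (s≢1+n ∘ sym)))
                       (ℤₚ.+-identityʳ (f s))

sumTo³-select : ∀ {a b c s₁ s₂ s₃} {F : ℕ → ℕ → ℕ → ℤ} → s₁ ≤ a → s₂ ≤ b → s₃ ≤ c →
  (∀ {t u v} → t ≤ a → u ≤ b → v ≤ c → ¬ (t ≡ s₁ × u ≡ s₂ × v ≡ s₃) → F t u v ≡ 0ℤ) →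
  (sumTo a λ t → sumTo b λ u → sumTo c λ v → F t u v) ≡ F s₁ s₂ s₃
sumTo³-select {a} {b} {c} s₁≤a s₂≤b s₃≤c off =
  trans (sumTo-select a s₁≤a λ t≤a t≢s₁ → sumTo-zero b λ u≤b → sumTo-zero c λ v≤c →
           off t≤a u≤b v≤c (t≢s₁ ∘ proj₁))
  (trans (sumTo-select b s₂≤b λ u≤b u≢s₂ → sumTo-zero c λ v≤c →
           off s₁≤a u≤b v≤c (u≢s₂ ∘ proj₁ ∘ proj₂))
         (sumTo-select c s₃≤c λ v≤c v≢s₃ → off s₁≤a s₂≤b v≤c (v≢s₃ ∘ proj₂ ∘ proj₂)))

sumTo-interchange : ∀ {_∙_ : ℤ → ℤ → ℤ} → Interchangable _∙_ ℤ._+_ →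
  ∀ n f g → sumTo n (λ t → f t ∙ g t) ≡ sumTo n f ∙ sumTo n g
sumTo-interchange         interchange zero    f g = refl
sumTo-interchange {_∙_} interchange (suc n) f g =
  trans (cong (ℤ._+ (f (suc n) ∙ g (suc n))) (sumTo-interchange {_∙_} interchange n f g))
        (sym (interchange (sumTo n f) (f (suc n)) (sumTo n g) (g (suc n))))

⊛-distribˡ : ∀ {_∙_ : ℤ → ℤ → ℤ} → ℤ._*_ DistributesOverˡ _∙_ → Interchangable _∙_ ℤ._+_ →
  ∀ f g h a b c → (f ⊛ (λ i j k → g i j k ∙ h i j k)) a b c ≡ (f ⊛ g) a b c ∙ (f ⊛ h) a b c
⊛-distribˡ {_∙_} distrib interchange f g h a b c =
  trans (sumTo-cong a λ {t} _ →
    trans (sumTo-cong b λ {u} _ →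
      trans (sumTo-cong c λ {v} _ → distrib (f t u v) _ _) (sum-interchange c _ _))
      (sum-interchange b _ _))
    (sum-interchange a _ _)
  where sum-interchange = sumTo-interchange {_∙_} interchange

⊛-distribˡ-⊕ : ∀ f g h a b c → (f ⊛ (g ⊕ h)) a b c ≡ (f ⊛ g) a b c ℤ.+ (f ⊛ h) a b c
⊛-distribˡ-⊕ = ⊛-distribˡ ℤₚ.*-distribˡ-+ +-interchange
  where
  +-interchange : ∀ w x y z → (w ℤ.+ x) ℤ.+ (y ℤ.+ z) ≡ (w ℤ.+ y) ℤ.+ (x ℤ.+ z)
  +-interchange = solve-∀

⊛-distribˡ-⊖ : ∀ f g h a b c → (f ⊛ (g ⊖ h)) a b c ≡ (f ⊛ g) a b c ℤ.- (f ⊛ h) a b c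
⊛-distribˡ-⊖ = ⊛-distribˡ *-distribˡ-minus minus-interchange
  where
  *-distribˡ-minus : ∀ x y z → x ℤ.* (y ℤ.- z) ≡ x ℤ.* y ℤ.- x ℤ.* z
  *-distribˡ-minus = solve-∀
  minus-interchange : ∀ w x y z → (w ℤ.+ x) ℤ.- (y ℤ.+ z) ≡ (w ℤ.- y) ℤ.+ (x ℤ.- z)
  minus-interchange = solve-∀

mono-on : ∀ i j k → mono i j k i j k ≡ 1ℤ
mono-on i j k = cong (if_then 1ℤ else 0ℤ) (dec-true ((i ≟ i) ×-dec (j ≟ j) ×-dec (k ≟ k)) (refl , refl , refl))

mono-off : ∀ {i j k x y z} → ¬ (x ≡ i × y ≡ j × z ≡ k) → mono i j k x y z ≡ 0ℤ
mono-off {i} {j} {k} {x} {y} {z} ≢ = cong (if_then 1ℤ else 0ℤ) (dec-false ((x ≟ i) ×-dec (y ≟ j) ×-dec (z ≟ k)) ≢)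

xyq∣_ : FPS → Set
xyq∣ g = ∀ a b c → a ≡ 0 ⊎ b ≡ 0 ⊎ c ≡ 0 → g a b c ≡ 0ℤ

-- When x^i y^j q^k does not divide x^a y^b q^c, truncated subtraction puts the right-hand side
-- on an axis, where g vanishes.
⊛-mono : ∀ {g} → xyq∣ g → ∀ i j k a b c → (g ⊛ mono i j k) a b c ≡ g (a ∸ i) (b ∸ j) (c ∸ k)
⊛-mono {g} xyq∣g i j k a b c =
  trans (sumTo³-select (m∸n≤m a i) (m∸n≤m b j) (m∸n≤m c k) off-support) on-support
  where
  ∸-inverse : ∀ {n t s} → t ≤ n → n ∸ t ≡ s → t ≡ n ∸ s
  ∸-inverse {n} t≤n refl = sym (m∸[m∸n]≡n t≤n)

  off-support : ∀ {t u v} → t ≤ a → u ≤ b → v ≤ c → ¬ (t ≡ a ∸ i × u ≡ b ∸ j × v ≡ c ∸ k) →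
                g t u v ℤ.* mono i j k (a ∸ t) (b ∸ u) (c ∸ v) ≡ 0ℤ
  off-support {t} {u} {v} t≤a u≤b v≤c ≢ =
    trans (cong (g t u v ℤ.*_)
                (mono-off λ (eᵢ , eⱼ , eₖ) → ≢ (∸-inverse t≤a eᵢ , ∸-inverse u≤b eⱼ , ∸-inverse v≤c eₖ)))
          (ℤₚ.*-zeroʳ (g t u v))

  vanishing : ∀ {w} → a ∸ i ≡ 0 ⊎ b ∸ j ≡ 0 ⊎ c ∸ k ≡ 0 →
              g (a ∸ i) (b ∸ j) (c ∸ k) ℤ.* w ≡ g (a ∸ i) (b ∸ j) (c ∸ k)
  vanishing {w} on-axis rewrite xyq∣g _ _ _ on-axis = ℤₚ.*-zeroˡ w

  on-support : g (a ∸ i) (b ∸ j) (c ∸ k) ℤ.* mono i j k (a ∸ (a ∸ i)) (b ∸ (b ∸ j)) (c ∸ (c ∸ k))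
             ≡ g (a ∸ i) (b ∸ j) (c ∸ k)
  on-support with i ≤? a | j ≤? b | k ≤? c
  ... | yes i≤a | yes j≤b | yes k≤c
      rewrite m∸[m∸n]≡n i≤a | m∸[m∸n]≡n j≤b | m∸[m∸n]≡n k≤c | mono-on i j k = ℤₚ.*-identityʳ _
  ... | no i≰a | _       | _       = vanishing (inj₁ (m≤n⇒m∸n≡0 (≰⇒≥ i≰a)))
  ... | yes _  | no j≰b  | _       = vanishing (inj₂ (inj₁ (m≤n⇒m∸n≡0 (≰⇒≥ j≰b))))
  ... | yes _  | yes _   | no k≰c  = vanishing (inj₂ (inj₂ (m≤n⇒m∸n≡0 (≰⇒≥ k≰c))))

⊛-1-minus : ∀ {g} → xyq∣ g → ∀ i j k i′ j′ k′ a b c →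
  (g ⊛ (mono 0 0 0 ⊖ (mono i j k ⊕ mono i′ j′ k′))) a b c
    ≡ g a b c ℤ.- (g (a ∸ i) (b ∸ j) (c ∸ k) ℤ.+ g (a ∸ i′) (b ∸ j′) (c ∸ k′))
⊛-1-minus {g} xyq∣g i j k i′ j′ k′ a b c =
  trans (⊛-distribˡ-⊖ g (mono 0 0 0) (mono i j k ⊕ mono i′ j′ k′) a b c)
        (cong₂ ℤ._-_ (⊛-mono xyq∣g 0 0 0 a b c)
                     (trans (⊛-distribˡ-⊕ g (mono i j k) (mono i′ j′ k′) a b c)
                            (cong₂ ℤ._+_ (⊛-mono xyq∣g i j k a b c) (⊛-mono xyq∣g i′ j′ k′ a b c))))

Σ-≡-irrelevant : ∀ {A : Set} {P : A → Set} → Irrelevant P → {x y : Σ A P} → proj₁ x ≡ proj₁ y → x ≡ y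
Σ-≡-irrelevant P-irrelevant e = Σ-≡,≡→≡ (e , P-irrelevant _ _)

∩-irrelevant : ∀ {A : Set} {P Q : A → Set} → Irrelevant P → Irrelevant Q → Irrelevant (P ∩ Q)
∩-irrelevant P-irrelevant Q-irrelevant (p , q) (p′ , q′) = cong₂ _,_ (P-irrelevant p p′) (Q-irrelevant q q′)

shifted-fiber : ∀ {k m m′} n → m′ ≡ k + m → 1 ≤ m → (m′ ≡ n ⇔ m ≡ n ∸ k)
shifted-fiber {k} {m} n refl 1≤m = mk⇔ (λ { refl → sym (m+n∸m≡n k m) }) from
  where
  from : m ≡ n ∸ k → k + m ≡ n
  from m≡n∸k = trans (cong (k +_) m≡n∸k) (m+[n∸m]≡n {k} (<⇒≤ (m∸n≢0⇒n<m (n>0⇒n≢0 (subst (1 ≤_) m≡n∸k 1≤m)))))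

Stats : ℕ → ℕ → ℕ → List ℕ → Set
Stats a b n l = largest l ≡ a × len l ≡ b × Γ l ≡ n

≡×≡×≡-irrelevant : ∀ {x₁ y₁ x₂ y₂ x₃ y₃ : ℕ} → Nullary.Irrelevant (x₁ ≡ y₁ × x₂ ≡ y₂ × x₃ ≡ y₃)
≡×≡×≡-irrelevant (eₐ , e_b , eₙ) (eₐ′ , e_b′ , eₙ′) =
  cong₂ _,_ (≡-irrelevant eₐ eₐ′) (cong₂ _,_ (≡-irrelevant e_b e_b′) (≡-irrelevant eₙ eₙ′))

Γ-∷ : ∀ p r → Γ (p ∷ r) ≡ p + length r
Γ-∷ p r = cong (_∸ 1) (+-suc p (length r))

partition-irrelevant : Irrelevant IsPartition
partition-irrelevant (linked , parts) (linked′ , parts′) =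
  cong₂ _,_ (Linked.irrelevant ≤-irrelevant linked linked′) (All.irrelevant ≤-irrelevant parts parts′)

Γ-positive : ∀ {p r} → IsPartition (p ∷ r) → 1 ≤ Γ (p ∷ r)
Γ-positive {p} {r} (_ , 1≤p ∷ _) = subst (1 ≤_) (sym (Γ-∷ p r)) (≤-trans 1≤p (m≤m+n p (length r)))

Γ≡1⇒[1] : ∀ {l} → IsPartition l → NonEmpty l → Γ l ≡ 1 → l ≡ 1 ∷ []
Γ≡1⇒[1] {p ∷ []}    _               _ Γ≡1 = cong (_∷ []) (trans (sym (+-identityʳ p)) (trans (sym (Γ-∷ p [])) Γ≡1))
Γ≡1⇒[1] {p ∷ q ∷ r} (_ , 1≤p ∷ _) _ Γ≡1 =
  contradiction (trans (sym (Γ-∷ p (q ∷ r))) Γ≡1) (>⇒≢ (+-mono-≤ 1≤p (s≤s (z≤n {length r}))))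

raise : ℕ → List ℕ → List ℕ
raise α []      = []
raise α (p ∷ r) = α + p ∷ r

prepend : ℕ → List ℕ → List ℕ
prepend β []      = []
prepend β (q ∷ r) = β + q ∷ q ∷ r

raise-injective : ∀ {α l l′} → raise α l ≡ raise α l′ → l ≡ l′
raise-injective {l = []}    {[]}      _ = refl
raise-injective {α} {p ∷ r} {p′ ∷ r′} e with ∷-injective e
... | α+p≡α+p′ , refl = cong (_∷ r) (+-cancelˡ-≡ α p p′ α+p≡α+p′)

prepend-injective : ∀ {β l l′} → prepend β l ≡ prepend β l′ → l ≡ l′
prepend-injective {l = []}    {[]}      _ = refl
prepend-injective {l = _ ∷ _} {_ ∷ _} e = ∷-injectiveʳ e

Γ-raise : ∀ α p r → Γ (raise α (p ∷ r)) ≡ α + Γ (p ∷ r)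
Γ-raise α p r = trans (Γ-∷ (α + p) r) (trans (+-assoc α p (length r)) (cong (α +_) (sym (Γ-∷ p r))))

Γ-prepend : ∀ β q r → Γ (prepend β (q ∷ r)) ≡ suc β + Γ (q ∷ r)
Γ-prepend β q r =
  trans (Γ-∷ (β + q) (q ∷ r))
        (trans (+-suc (β + q) (length r)) (cong suc (trans (+-assoc β q (length r)) (cong (β +_) (sym (Γ-∷ q r))))))

raise-partition : ∀ α {l} → IsPartition l → IsPartition (raise α l)
raise-partition α {[]}    π                    = π
raise-partition α {p ∷ r} (linked , 1≤p ∷ 1≤r) = raise-head linked , ≤-trans 1≤p (m≤n+m p α) ∷ 1≤r
  where
  raise-head : ∀ {r} → Linked _≥_ (p ∷ r) → Linked _≥_ (α + p ∷ r)
  raise-head [-]             = [-]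
  raise-head (p≥q ∷ linked) = ≤-trans p≥q (m≤n+m p α) ∷ linked

prepend-partition : ∀ β {l} → IsPartition l → IsPartition (prepend β l)
prepend-partition β {[]}    π                             = π
prepend-partition β {q ∷ r} (linked , parts@(1≤q ∷ _)) = m≤n+m q β ∷ linked , ≤-trans 1≤q (m≤n+m q β) ∷ parts

data Origin (Member : List ℕ → Set) (α β : ℕ) (l : List ℕ) : Set where
  raised    : ∀ {l′} → Member l′ → l ≡ raise α l′   → Origin Member α β l
  prepended : ∀ {l′} → Member l′ → l ≡ prepend β l′ → Origin Member α β l

-- The members other than (1) are exactly the images of members under raise α and prepend β;
-- `gap` keeps the two images disjoint.
record Decomposition (α β : ℕ) : Set₁ where
  field
    Member            : List ℕ → Set
    member-irrelevant : Irrelevant Member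
    member-partition  : ∀ {l} → Member l → IsPartition l × NonEmpty l
    1≤α               : 1 ≤ α
    gap               : ∀ {p q r} → Member (p ∷ q ∷ r) → β + q ≤ p
    [1]-member        : Member (1 ∷ [])
    raise-member      : ∀ {l} → Member l → Member (raise α l)
    prepend-member    : ∀ {l} → Member l → Member (prepend β l)
    origin            : ∀ {l} → Member l → l ≢ 1 ∷ [] → Origin Member α β l

module _ {α β} (D : Decomposition α β) where
  open Decomposition D

  []∉Member : ¬ Member []
  []∉Member m with member-partition m
  ... | _ , ()

  stats-positive : ∀ {l} → Member l → 1 ≤ largest l × 1 ≤ len l × 1 ≤ Γ l
  stats-positive {[]}    m = contradiction m []∉Member
  stats-positive {p ∷ r} m with member-partition m
  ... | π@(_ , 1≤p ∷ _) , nonempty = 1≤p , nonempty , Γ-positive π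

  list-≡⇒≡ : ∀ {P : List ℕ → Set} → Irrelevant P → {x y : Σ (List ℕ) (Member ∩ P)} → proj₁ x ≡ proj₁ y → x ≡ y
  list-≡⇒≡ {P} P-irrelevant = Σ-≡-irrelevant (∩-irrelevant {P = Member} {Q = P} member-irrelevant P-irrelevant)

  raise≢prepend : ∀ {l l′} → Member l → raise α l ≢ prepend β l′
  raise≢prepend {[]}        {[]}     m _  = []∉Member m
  raise≢prepend {_ ∷ _}     {[]}     _ ()
  raise≢prepend {p ∷ []}    {_ ∷ _}  _ ()
  raise≢prepend {p ∷ q ∷ r} {_ ∷ _}  m e with ∷-injective e
  ... | α+p≡β+q , refl = <⇒≱ (m<n+m p 1≤α) (subst (_≤ p) (sym α+p≡β+q) (gap m))

  split : ∀ {Q Q₁ Q₂ : List ℕ → Set} → Irrelevant Q → Irrelevant Q₁ → Irrelevant Q₂ →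
    (∀ {l} → Member l → Q (raise α l) ⇔ Q₁ l) → (∀ {l} → Member l → Q (prepend β l) ⇔ Q₂ l) → ¬ Q (1 ∷ []) →
    Σ (List ℕ) (Member ∩ Q) ↔ (Σ (List ℕ) (Member ∩ Q₁) ⊎ Σ (List ℕ) (Member ∩ Q₂))
  split {Q} {Q₁} {Q₂} Q-irrelevant Q₁-irrelevant Q₂-irrelevant raise-fiber prepend-fiber [1]∉Q =
    mk↔ₛ′ to from to∘from from∘to
    where
    Target = Σ (List ℕ) (Member ∩ Q₁) ⊎ Σ (List ℕ) (Member ∩ Q₂)

    origin-of : ∀ {l} → Member l → Q l → Origin Member α β l
    origin-of m q = origin m λ { refl → [1]∉Q q }

    to-origin : ∀ {l} → Origin Member α β l → Q l → Target
    to-origin (raised    {l′} m′ e) q = inj₁ (l′ , m′ , Equivalence.to (raise-fiber m′) (subst Q e q))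
    to-origin (prepended {l′} m′ e) q = inj₂ (l′ , m′ , Equivalence.to (prepend-fiber m′) (subst Q e q))

    to : Σ (List ℕ) (Member ∩ Q) → Target
    to (_ , m , q) = to-origin (origin-of m q) q

    from : Target → Σ (List ℕ) (Member ∩ Q)
    from (inj₁ (l , m , q₁)) = raise α l , raise-member m , Equivalence.from (raise-fiber m) q₁
    from (inj₂ (l , m , q₂)) = prepend β l , prepend-member m , Equivalence.from (prepend-fiber m) q₂

    from∘to : ∀ x → from (to x) ≡ x
    from∘to (l , m , q) = by-origin (origin-of m q)
      where
      by-origin : (o : Origin Member α β l) → from (to-origin o q) ≡ (l , m , q)
      by-origin (raised    _ e) = list-≡⇒≡ Q-irrelevant (sym e)
      by-origin (prepended _ e) = list-≡⇒≡ Q-irrelevant (sym e)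

    to∘from : ∀ y → to (from y) ≡ y
    to∘from y@(inj₁ (l , m , q₁)) = by-origin (origin-of (raise-member m) q)
      where
      q = Equivalence.from (raise-fiber m) q₁
      by-origin : (o : Origin Member α β (raise α l)) → to-origin o q ≡ y
      by-origin (raised    _  e) = cong inj₁ (list-≡⇒≡ Q₁-irrelevant (sym (raise-injective e)))
      by-origin (prepended _  e) = contradiction e (raise≢prepend m)
    to∘from y@(inj₂ (l , m , q₂)) = by-origin (origin-of (prepend-member m) q)
      where
      q = Equivalence.from (prepend-fiber m) q₂
      by-origin : (o : Origin Member α β (prepend β l)) → to-origin o q ≡ y
      by-origin (raised    m′ e) = contradiction (sym e) (raise≢prepend m′)
      by-origin (prepended _  e) = cong inj₂ (list-≡⇒≡ Q₂-irrelevant (sym (prepend-injective e)))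

  raise-stats : ∀ {l} → Member l →
    largest (raise α l) ≡ α + largest l × len (raise α l) ≡ 0 + len l × Γ (raise α l) ≡ α + Γ l
  raise-stats {[]}    m = contradiction m []∉Member
  raise-stats {p ∷ r} _ = refl , refl , Γ-raise α p r

  prepend-stats : ∀ {l} → Member l →
    largest (prepend β l) ≡ β + largest l × len (prepend β l) ≡ 1 + len l × Γ (prepend β l) ≡ suc β + Γ l
  prepend-stats {[]}    m = contradiction m []∉Member
  prepend-stats {q ∷ r} _ = refl , refl , Γ-prepend β q r

  Γ-raise-fiber : ∀ {n l} → Member l → (Γ (raise α l) ≡ n) ⇔ (Γ l ≡ n ∸ α)
  Γ-raise-fiber {n} m = shifted-fiber n (proj₂ (proj₂ (raise-stats m))) (proj₂ (proj₂ (stats-positive m)))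

  Γ-prepend-fiber : ∀ {n l} → Member l → (Γ (prepend β l) ≡ n) ⇔ (Γ l ≡ n ∸ suc β)
  Γ-prepend-fiber {n} m = shifted-fiber n (proj₂ (proj₂ (prepend-stats m))) (proj₂ (proj₂ (stats-positive m)))

  stats-raise : ∀ {a b n l} → Member l → Stats a b n (raise α l) ⇔ Stats (a ∸ α) b (n ∸ α) l
  stats-raise {a} {b} {n} m =
    let (eₐ , eₗ , _) = raise-stats m ; (1≤a , 1≤ℓ , _) = stats-positive m in
    shifted-fiber a eₐ 1≤a ×-⇔ shifted-fiber {0} b eₗ 1≤ℓ ×-⇔ Γ-raise-fiber m

  stats-prepend : ∀ {a b n l} → Member l → Stats a b n (prepend β l) ⇔ Stats (a ∸ β) (b ∸ 1) (n ∸ suc β) l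
  stats-prepend {a} {b} {n} m =
    let (eₐ , eₗ , _) = prepend-stats m ; (1≤a , 1≤ℓ , _) = stats-positive m in
    shifted-fiber a eₐ 1≤a ×-⇔ shifted-fiber b eₗ 1≤ℓ ×-⇔ Γ-prepend-fiber m

  member-Γ≡1⇒[1] : ∀ {l} → Member l → Γ l ≡ 1 → l ≡ 1 ∷ []
  member-Γ≡1⇒[1] m = uncurry Γ≡1⇒[1] (member-partition m)

  module _ (c : ℕ → ℕ → ℕ → ℕ) (c↔ : ∀ a b n → Fin (c a b n) ↔ Σ (List ℕ) (Member ∩ Stats a b n)) where

    count-on-axes : ∀ {a b n} → a ≡ 0 ⊎ b ≡ 0 ⊎ n ≡ 0 → c a b n ≡ 0
    count-on-axes (inj₁ refl)        = card-empty (c↔ _ _ _)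
      λ (_ , m , eₐ , _) → n>0⇒n≢0 (proj₁ (stats-positive m)) eₐ
    count-on-axes (inj₂ (inj₁ refl)) = card-empty (c↔ _ _ _)
      λ (_ , m , _ , eₗ , _) → n>0⇒n≢0 (proj₁ (proj₂ (stats-positive m))) eₗ
    count-on-axes (inj₂ (inj₂ refl)) = card-empty (c↔ _ _ _)
      λ (_ , m , _ , _ , eₙ) → n>0⇒n≢0 (proj₂ (proj₂ (stats-positive m))) eₙ

    xyq∣count : xyq∣ fromℕ c
    xyq∣count _ _ _ on-axis = cong ℤ.+_ (count-on-axes on-axis)

    count-[1] : c 1 1 1 ≡ 1
    count-[1] = card-singleton (c↔ 1 1 1) (1 ∷ [] , [1]-member , refl , refl , refl)
      λ (_ , m , _ , _ , Γ≡1) → list-≡⇒≡ ≡×≡×≡-irrelevant (sym (member-Γ≡1⇒[1] m Γ≡1))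

    count-step : ∀ {a b n} → ¬ (a ≡ 1 × b ≡ 1 × n ≡ 1) →
      c a b n ≡ c (a ∸ α) b (n ∸ α) + c (a ∸ β) (b ∸ 1) (n ∸ suc β)
    count-step ≢111 = card-⊎ (c↔ _ _ _) (c↔ _ _ _) (c↔ _ _ _)
      (split ≡×≡×≡-irrelevant ≡×≡×≡-irrelevant ≡×≡×≡-irrelevant stats-raise stats-prepend
             λ (1≡a , 1≡b , 1≡n) → ≢111 (sym 1≡a , sym 1≡b , sym 1≡n))

    coefficient-recurrence : ∀ a b n →
      fromℕ c a b n ℤ.- (fromℕ c (a ∸ α) b (n ∸ α) ℤ.+ fromℕ c (a ∸ β) (b ∸ 1) (n ∸ suc β)) ≡ mono 1 1 1 a b n
    coefficient-recurrence a b n with (a ≟ 1) ×-dec (b ≟ 1) ×-dec (n ≟ 1)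
    ... | yes (refl , refl , refl)
        rewrite count-[1] | count-on-axes {1 ∸ α} {1} {1 ∸ α} (inj₁ (m≤n⇒m∸n≡0 1≤α))
              | count-on-axes {1 ∸ β} {0} {0 ∸ β} (inj₂ (inj₁ refl)) = refl
    ... | no ≢111 = begin
      fromℕ c a b n ℤ.- (ℤ.+ x ℤ.+ ℤ.+ y)   ≡⟨ cong (ℤ._- (ℤ.+ x ℤ.+ ℤ.+ y)) count-splits ⟩
      (ℤ.+ x ℤ.+ ℤ.+ y) ℤ.- (ℤ.+ x ℤ.+ ℤ.+ y) ≡⟨ ℤₚ.+-inverseʳ (ℤ.+ x ℤ.+ ℤ.+ y) ⟩
      0ℤ                                    ≡⟨ mono-off ≢111 ⟨
      mono 1 1 1 a b n                      ∎
      where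
      open ≡-Reasoning
      x = c (a ∸ α) b (n ∸ α)
      y = c (a ∸ β) (b ∸ 1) (n ∸ suc β)
      count-splits : fromℕ c a b n ≡ ℤ.+ x ℤ.+ ℤ.+ y
      count-splits = trans (cong ℤ.+_ (count-step ≢111)) (ℤₚ.pos-+ x y)

  module _ (c : ℕ → ℕ) (c↔ : ∀ n → Fin (c n) ↔ Σ (List ℕ) (Member ∩ (λ l → Γ l ≡ n))) where

    Γ-count-0 : c 0 ≡ 0
    Γ-count-0 = card-empty (c↔ 0) λ (_ , m , Γ≡0) → n>0⇒n≢0 (proj₂ (proj₂ (stats-positive m))) Γ≡0

    Γ-count-1 : c 1 ≡ 1
    Γ-count-1 = card-singleton (c↔ 1) (1 ∷ [] , [1]-member , refl)
      λ (_ , m , Γ≡1) → list-≡⇒≡ ≡-irrelevant (sym (member-Γ≡1⇒[1] m Γ≡1))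

    Γ-count-step : ∀ m → c (2 + m) ≡ c (2 + m ∸ α) + c (1 + m ∸ β)
    Γ-count-step m = card-⊎ (c↔ _) (c↔ _) (c↔ _)
      (split ≡-irrelevant ≡-irrelevant ≡-irrelevant
             Γ-raise-fiber Γ-prepend-fiber λ ())

recurrence-unique : ∀ s t {f g : ℕ → ℕ} → f 0 ≡ g 0 → f 1 ≡ g 1 →
  (∀ m → f (2 + m) ≡ f (1 + m ∸ s) + f (1 + m ∸ t)) →
  (∀ m → g (2 + m) ≡ g (1 + m ∸ s) + g (1 + m ∸ t)) →
  ∀ n → f n ≡ g n
recurrence-unique s t {f} {g} f0≡g0 f1≡g1 f-step g-step = <-rec (λ n → f n ≡ g n) agree
  where
  agree : ∀ n → (∀ {m} → m < n → f m ≡ g m) → f n ≡ g n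
  agree 0             _     = f0≡g0
  agree 1             _     = f1≡g1
  agree (suc (suc m)) below = begin
    f (2 + m)                     ≡⟨ f-step m ⟩
    f (1 + m ∸ s) + f (1 + m ∸ t) ≡⟨ cong₂ _+_ (below (s≤s (m∸n≤m (1 + m) s))) (below (s≤s (m∸n≤m (1 + m) t))) ⟩
    g (1 + m ∸ s) + g (1 + m ∸ t) ≡⟨ g-step m ⟨
    g (2 + m)                     ∎
    where open ≡-Reasoning

m<n∧m%o≡n%o⇒m+o≤n : ∀ {m n} o .{{_ : NonZero o}} → m < n → m % o ≡ n % o → m + o ≤ n
m<n∧m%o≡n%o⇒m+o≤n {m} {n} o m<n m%o≡n%o = begin
  m + o                   ≡⟨ cong (_+ o) (m≡m%n+[m/n]*n m o) ⟩
  m % o + m / o * o + o   ≡⟨ +-assoc (m % o) (m / o * o) o ⟩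
  m % o + (m / o * o + o) ≡⟨ cong (m % o +_) (+-comm (m / o * o) o) ⟩
  m % o + suc (m / o) * o ≤⟨ +-mono-≤ (≤-reflexive m%o≡n%o) (*-monoˡ-≤ o m/o<n/o) ⟩
  n % o + n / o * o       ≡⟨ m≡m%n+[m/n]*n n o ⟨
  n                       ∎
  where
  open ≤-Reasoning
  m/o<n/o : m / o < n / o
  m/o<n/o = *-cancelʳ-< o (m / o) (n / o) (+-cancelˡ-< (m % o) (m / o * o) (n / o * o)
    (subst₂ _<_ (m≡m%n+[m/n]*n m o) (trans (m≡m%n+[m/n]*n n o) (cong (_+ n / o * o) (sym m%o≡n%o))) m<n))

module _ (d : ℕ) where

  InH-irrelevant : Irrelevant (InH d)
  InH-irrelevant (π , ne , gaps) (π′ , ne′ , gaps′) =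
    cong₂ _,_ (partition-irrelevant π π′) (cong₂ _,_ (≤-irrelevant ne ne′) (AllPairs.irrelevant ≤-irrelevant gaps gaps′))

  InH-raise : ∀ {l} → InH d l → InH d (raise 1 l)
  InH-raise {[]}    m                     = m
  InH-raise {p ∷ r} (π , ne , gaps ∷ pairs) = raise-partition 1 π , ne , All.map m≤n⇒m≤1+n gaps ∷ pairs

  InH-prepend : ∀ {l} → InH d l → InH d (prepend d l)
  InH-prepend {[]}    m                               = m
  InH-prepend {q ∷ r} (π , _ , pairs@(gaps ∷ _)) =
    prepend-partition d π , s≤s z≤n ,
    (≤-reflexive (+-comm q d) ∷ All.map (λ y+d≤q → ≤-trans y+d≤q (m≤n+m q d)) gaps) ∷ pairs

  InH-lower : ∀ {p q r} → InH d (suc p ∷ q ∷ r) → q + d ≤ p → InH d (p ∷ q ∷ r)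
  InH-lower {p} {q} ((_ ∷ linked , _ ∷ parts@(1≤q ∷ _)) , ne , (_ ∷ _) ∷ pairs@(gaps ∷ _)) q+d≤p =
    (q≤p ∷ linked , ≤-trans 1≤q q≤p ∷ parts) , ne ,
    (q+d≤p ∷ All.map (λ y+d≤q → ≤-trans y+d≤q q≤p) gaps) ∷ pairs
    where
    q≤p : q ≤ p
    q≤p = m+n≤o⇒m≤o q q+d≤p

  InH-tail : ∀ {p q r} → InH d (p ∷ q ∷ r) → InH d (q ∷ r)
  InH-tail ((_ ∷ linked , _ ∷ parts) , _ , _ ∷ pairs) = (linked , parts) , s≤s z≤n , pairs

  InH-origin : ∀ {l} → InH d l → l ≢ 1 ∷ [] → Origin (InH d) 1 d l
  InH-origin {0 ∷ _}            ((_ , () ∷ _) , _) _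
  InH-origin {1 ∷ []}           _ l≢[1] = contradiction refl l≢[1]
  InH-origin {suc (suc p) ∷ []} _ _     = raised (([-] , s≤s z≤n ∷ []) , s≤s z≤n , [] ∷ []) refl
  InH-origin {suc p ∷ q ∷ r}    m@(_ , _ , (q+d≤1+p ∷ _) ∷ _) _ with suc p ≟ d + q
  ... | yes 1+p≡d+q = prepended (InH-tail m) (cong (_∷ q ∷ r) 1+p≡d+q)
  ... | no 1+p≢d+q = raised (InH-lower m (m<1+n⇒m≤n (≤∧≢⇒< q+d≤1+p q+d≢1+p))) refl
    where
    q+d≢1+p : q + d ≢ suc p
    q+d≢1+p q+d≡1+p = 1+p≢d+q (trans (sym q+d≡1+p) (+-comm q d))

  H-decomposition : Decomposition 1 d
  H-decomposition = record
    { Member            = InH d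
    ; member-irrelevant = InH-irrelevant
    ; member-partition  = λ (π , ne , _) → π , ne
    ; 1≤α               = s≤s z≤n
    ; gap               = λ { {p} {q} (_ , _ , (q+d≤p ∷ _) ∷ _) → subst (_≤ p) (+-comm q d) q+d≤p }
    ; [1]-member        = ([-] , s≤s z≤n ∷ []) , s≤s z≤n , [] ∷ []
    ; raise-member      = InH-raise
    ; prepend-member    = InH-prepend
    ; origin            = InH-origin
    }

module _ (d : ℕ) where

  InF-irrelevant : Irrelevant (InF d)
  InF-irrelevant (π , ne , mods) (π′ , ne′ , mods′) =
    cong₂ _,_ (partition-irrelevant π π′) (cong₂ _,_ (≤-irrelevant ne ne′) (All.irrelevant ≡-irrelevant mods mods′))

  InF-raise : ∀ {l} → InF d l → InF d (raise (suc d) l)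
  InF-raise {[]}    m                       = m
  InF-raise {p ∷ r} (π , ne , p≡1 ∷ mods) = raise-partition (suc d) π , ne , trans (%-remove-+ˡ p ∣-refl) p≡1 ∷ mods

  InF-prepend : ∀ {l} → InF d l → InF d (prepend 0 l)
  InF-prepend {[]}    m                           = m
  InF-prepend {q ∷ r} (π , _ , mods@(q≡1 ∷ _)) = prepend-partition 0 π , s≤s z≤n , q≡1 ∷ mods

  InF-origin : ∀ {l} → InF d l → l ≢ 1 ∷ [] → Origin (InF d) (suc d) 0 l
  InF-origin {0 ∷ _}  ((_ , () ∷ _) , _) _
  InF-origin {1 ∷ []} _ l≢[1] = contradiction refl l≢[1]
  InF-origin {suc (suc p) ∷ []} (_ , _ , p≡1 ∷ []) _ =
    raised (([-] , m+n≤o⇒m≤o∸n 1 gap ∷ []) , s≤s z≤n , trans (m≤n⇒[n∸m]%m≡n%m 1+d≤p) p≡1 ∷ [])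
           (cong (_∷ []) (sym (m+[n∸m]≡n 1+d≤p)))
    where
    gap : 1 + suc d ≤ suc (suc p)
    gap = m<n∧m%o≡n%o⇒m+o≤n (suc d) (s≤s (s≤s z≤n)) (sym p≡1)
    1+d≤p : suc d ≤ suc (suc p)
    1+d≤p = m+n≤o⇒n≤o 1 gap
  InF-origin {p ∷ q ∷ r} ((q≤p ∷ linked , _ ∷ parts@(1≤q ∷ _)) , _ , p≡1 ∷ mods@(q≡1 ∷ _)) _ with p ≟ q
  ... | yes refl = prepended ((linked , parts) , s≤s z≤n , mods) refl
  ... | no p≢q   =
    raised ((q≤p∸1+d ∷ linked , ≤-trans 1≤q q≤p∸1+d ∷ parts) , s≤s z≤n , trans (m≤n⇒[n∸m]%m≡n%m 1+d≤p) p≡1 ∷ mods)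
           (cong (_∷ q ∷ r) (sym (m+[n∸m]≡n 1+d≤p)))
    where
    gap : q + suc d ≤ p
    gap = m<n∧m%o≡n%o⇒m+o≤n (suc d) (≤∧≢⇒< q≤p (p≢q ∘ sym)) (trans q≡1 (sym p≡1))
    1+d≤p : suc d ≤ p
    1+d≤p = m+n≤o⇒n≤o q gap
    q≤p∸1+d : q ≤ p ∸ suc d
    q≤p∸1+d = m+n≤o⇒m≤o∸n q gap

  F-decomposition : Decomposition (suc d) 0
  F-decomposition = record
    { Member            = InF d
    ; member-irrelevant = InF-irrelevant
    ; member-partition  = λ (π , ne , _) → π , ne
    ; 1≤α               = s≤s z≤n
    ; gap               = λ { ((q≤p ∷ _ , _) , _) → q≤p }
    ; [1]-member        = ([-] , s≤s z≤n ∷ []) , s≤s z≤n , refl ∷ []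
    ; raise-member      = InF-raise
    ; prepend-member    = InF-prepend
    ; origin            = InF-origin
    }

H-generating-function : ∀ d (h : ℕ → ℕ → ℕ → ℕ) → (∀ a b n → Fin (h a b n) ↔ HSet d a b n) →
  ∀ a b n → (fromℕ h ⊛ denomH d) a b n ≡ mono 1 1 1 a b n
H-generating-function d h h↔ a b n =
  trans (⊛-1-minus (xyq∣count D h h↔) 1 0 1 d 1 (suc d) a b n) (coefficient-recurrence D h h↔ a b n)
  where D = H-decomposition d

F-generating-function : ∀ d (f : ℕ → ℕ → ℕ → ℕ) → (∀ a b n → Fin (f a b n) ↔ FSet d a b n) →
  ∀ a b n → (fromℕ f ⊛ denomF d) a b n ≡ mono 1 1 1 a b n
F-generating-function d f f↔ a b n =
  trans (⊛-1-minus (xyq∣count D f f↔) 0 1 1 (suc d) 0 (suc d) a b n)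
        (trans (cong (ℤ._-_ (fromℕ f a b n)) swap) (coefficient-recurrence D f f↔ a b n))
  where
  D = F-decomposition d
  swap = ℤₚ.+-comm (fromℕ f a (b ∸ 1) (n ∸ 1)) (fromℕ f (a ∸ suc d) b (n ∸ suc d))

Γ-counts-agree : ∀ d (hd fd : ℕ → ℕ) → (∀ n → Fin (hd n) ↔ HΓ d n) → (∀ n → Fin (fd n) ↔ FΓ d n) →
  ∀ n → hd n ≡ fd n
Γ-counts-agree d hd fd hd↔ fd↔ = recurrence-unique 0 d
  (trans (Γ-count-0 H hd hd↔) (sym (Γ-count-0 F fd fd↔)))
  (trans (Γ-count-1 H hd hd↔) (sym (Γ-count-1 F fd fd↔)))
  (Γ-count-step H hd hd↔)
  (λ m → trans (Γ-count-step F fd fd↔ m) (+-comm (fd (1 + m ∸ d)) (fd (1 + m))))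
  where
  H = H-decomposition d
  F = F-decomposition d

theorem2p15 : (d : ℕ) → 1 ≤ d →
    ((h : ℕ → ℕ → ℕ → ℕ) → (∀ a b n → Fin (h a b n) ↔ HSet d a b n) →
    ∀ a b n → (fromℕ h ⊛ denomH d) a b n ≡ mono 1 1 1 a b n)
    ×
    ((f : ℕ → ℕ → ℕ → ℕ) → (∀ a b n → Fin (f a b n) ↔ FSet d a b n) →
    ∀ a b n → (fromℕ f ⊛ denomF d) a b n ≡ mono 1 1 1 a b n)
    ×
    ((hd fd : ℕ → ℕ) → (∀ n → Fin (hd n) ↔ HΓ d n) → (∀ n → Fin (fd n) ↔ FΓ d n) →
    ∀ n → 1 ≤ n → hd n ≡ fd n)
theorem2p15 d _ =
  H-generating-function d , F-generating-function d , λ hd fd hd↔ fd↔ n _ → Γ-counts-agree d hd fd hd↔ fd↔ n
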